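{- Let $\pi\in S_n$, let $V$ be a set of points in the plot of $\pi$, and suppose there is a bijection $\phi$ from the set of descent tops of $\pi$ to $V$ such that whenever $\phi(i,\pi_i)=(j,\pi_j)$: (i) $j>i$ and $\pi_j>\pi_i$; and (ii) there is no $k$ with $i<k<j$ and $\pi_k>\pi_j$. Then there is a valid hook configuration on $\pi$ whose set of northeast endpoints is $V$.
   Context: For $\pi\in S_n$, its plot is $\{(i,\pi_i):i\in[n]\}$. $(i,\pi_i)$ is a descent top if $i<n$ and $\pi_i>\pi_{i+1}$. A hook from $(i,\pi_i)$ to $(j,\pi_j)$, defined when $i<j$ and $\pi_i<\pi_j$, is the union of the vertical segment from $(i,\pi_i)$ to $(i,\pi_j)$ and the horizontal segment from $(i,\pi_j)$ to $(j,\pi_j)$; $(i,\pi_i)$ is the southwest endpoint, $(j,\pi_j)$ the northeast endpoint. A valid hook configuration on $\pi$ is a set of hooks such that (i) the set of southwest endpoints is exactly the set of descent tops; (ii) no point of the plot lies above a hook, i.e. for a hook from $(i,\pi_i)$ to $(j,\pi_j)$ there is no $k$ with $i<k<j$ and $\pi_k>\pi_j$; (iii) hooks do not intersect each other except at their endpoints.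
   Formalization: The requirement that hooks do not intersect each other except at their endpoints is imposed only at points of the plane with rational coordinates. -}

module Defs where

open import Data.Nat using (ℕ; suc)
open import Data.Fin using (Fin; toℕ) renaming (_<_ to _<ᶠ_)
open import Data.Fin.Permutation using (Permutation′; _⟨$⟩ʳ_)
open import Data.Fin.Subset using (Subset; _∈_)
open import Data.Integer using (+_)
open import Data.Rational using (ℚ; _/_; _≤_)
open import Data.Product using (Σ; ∃; _×_; _,_)
open import Data.Sum using (_⊎_)
open import Data.Empty using (⊥)
open import Relation.Binary.PropositionalEquality using (_≡_)
open import Function.Bundles using (_⇔_)

-- Positions and values are 0-based: the point of the plot at position i is
-- (i , π i), where i : Fin n.  A point of the plot is identified with its
-- position i (the map i ↦ (i , π i) is a bijection onto the plot).

DescentTop : ∀ {n} → Permutation′ n → Fin n → Set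
DescentTop {n} π i =
  Σ (Fin n) λ i' → (toℕ i' ≡ suc (toℕ i)) × ((π ⟨$⟩ʳ i') <ᶠ (π ⟨$⟩ʳ i))

IsHook : ∀ {n} → Permutation′ n → Fin n → Fin n → Set
IsHook π i j = (i <ᶠ j) × ((π ⟨$⟩ʳ i) <ᶠ (π ⟨$⟩ʳ j))

NothingAbove : ∀ {n} → Permutation′ n → Fin n → Fin n → Set
NothingAbove π i j = ∀ k → i <ᶠ k → k <ᶠ j → (π ⟨$⟩ʳ j) <ᶠ (π ⟨$⟩ʳ k) → ⊥

ι : ∀ {n} → Fin n → ℚ
ι i = + (toℕ i) / 1

OnHook : ∀ {n} → Permutation′ n → Fin n → Fin n → ℚ → ℚ → Set
OnHook π i j x y =
    ((x ≡ ι i) × (ι (π ⟨$⟩ʳ i) ≤ y) × (y ≤ ι (π ⟨$⟩ʳ j)))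
  ⊎ ((y ≡ ι (π ⟨$⟩ʳ j)) × (ι i ≤ x) × (x ≤ ι j))

IsEndpoint : ∀ {n} → Permutation′ n → Fin n → Fin n → ℚ → ℚ → Set
IsEndpoint π i j x y =
    ((x ≡ ι i) × (y ≡ ι (π ⟨$⟩ʳ i)))
  ⊎ ((x ≡ ι j) × (y ≡ ι (π ⟨$⟩ʳ j)))

HookSet : ℕ → Set₁
HookSet n = Fin n → Fin n → Set

record ValidHookConfiguration {n} (π : Permutation′ n) (H : HookSet n) : Set where
  field
    hooks      : ∀ i j → H i j → IsHook π i j
    southwest  : ∀ i → (∃ λ j → H i j) ⇔ DescentTop π i
    noneAbove  : ∀ i j → H i j → NothingAbove π i j
    noCrossing : ∀ i j i' j' → H i j → H i' j' → ((i ≡ i') × (j ≡ j') → ⊥) →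
                 ∀ x y → OnHook π i j x y → OnHook π i' j' x y →
                 IsEndpoint π i j x y ⊎ IsEndpoint π i' j' x y

NortheastEndpoints : ∀ {n} → HookSet n → Subset n → Set
NortheastEndpoints H V = ∀ j → (∃ λ i → H i j) ⇔ (j ∈ V)

module Submission where

-- Call an *assignment* a map f sending
-- the descent tops of π bijectively onto V such that every hook i → f i is
-- *admissible*, i.e. is a hook with no point of the plot above it; the
-- hypotheses of the theorem say precisely that φ is one.  The hooks at k and
-- at i' *cross* when k < i' < f k < f i'.  Exchanging the northeast endpoints
-- of two crossing hooks yields again an assignment, and the hook at k becomes
-- strictly longer.  Sweeping the descent tops from left to right and swapping
-- at the current one as long as it crosses some hook therefore terminates, and
-- a swap at k never creates a crossing at a descent top to the left of k.  In
-- the resulting crossing-free assignment distinct hooks meet only at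
-- endpoints: a vertical segment of the hook at a meeting the interior of the
-- horizontal segment of the hook at c would give c < a < f a < f c with
-- π (f c) ≤ π (f a), contradicting admissibility of the hook at c.

open import Defs
open import Data.Nat using (ℕ)
open import Data.Fin using (Fin) renaming (_<_ to _<ᶠ_)
open import Data.Fin.Permutation using (Permutation′; _⟨$⟩ʳ_)
open import Data.Fin.Subset using (Subset; _∈_)
open import Data.Product using (Σ; ∃; _×_; _,_)
open import Relation.Binary.PropositionalEquality using (_≡_)

import Data.Nat as ℕ
import Data.Nat.Properties as ℕP
open import Data.Fin using (toℕ; fromℕ<; _≟_) renaming (_≤_ to _≤ᶠ_; _>_ to _>ᶠ_)
import Data.Fin.Properties as FinP
open import Data.Fin.Induction using (>-wellFounded)
open import Data.Fin.Permutation.Components using (transpose; transpose-inverse)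
import Data.Integer as ℤ
import Data.Integer.Properties as ℤP
import Data.Rational as ℚ
import Data.Rational.Properties as ℚP
import Data.Nat.Coprimality as Coprimality
open import Data.Product using (proj₁; proj₂)
open import Data.Sum using (_⊎_; inj₁; inj₂)
open import Data.Empty using (⊥; ⊥-elim)
open import Function using (_∘_; Injection)
open import Function.Properties.Inverse using (↔⇒↣)
open import Function.Bundles using (mk⇔)
open import Induction.WellFounded using (Acc; acc)
open import Relation.Nullary using (Dec; yes; no; ¬_)
open import Relation.Nullary.Decidable using (_×-dec_)
open import Relation.Unary using (Decidable)
open import Relation.Binary using (tri<; tri≈; tri>)
open import Relation.Binary.PropositionalEquality
  using (_≢_; refl; sym; trans; cong; subst; subst₂)

ι≡mkℚ : ∀ {n} (i : Fin n) →
        ι i ≡ ℚ.mkℚ (ℤ.+ toℕ i) 0 (Coprimality.sym (Coprimality.1-coprimeTo (toℕ i)))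
ι≡mkℚ i = ℚP.normalize-coprime _

ι-cancel-≤ : ∀ {n} {i j : Fin n} → ι i ℚ.≤ ι j → i ≤ᶠ j
ι-cancel-≤ {i = i} {j} ιi≤ιj rewrite ι≡mkℚ i | ι≡mkℚ j with ιi≤ιj
... | ℚ.*≤* i*1≤j*1 = ℤP.drop‿+≤+
  (subst₂ ℤ._≤_ (ℤP.*-identityʳ (ℤ.+ toℕ i)) (ℤP.*-identityʳ (ℤ.+ toℕ j)) i*1≤j*1)

ι-injective : ∀ {n} {i j : Fin n} → ι i ≡ ι j → i ≡ j
ι-injective e = FinP.≤-antisym (ι-cancel-≤ (ℚP.≤-reflexive e)) (ι-cancel-≤ (ℚP.≤-reflexive (sym e)))

transpose-elim : ∀ {n} (P : Fin n → Fin n → Set) (a b : Fin n) →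
                 P a b → P b a → (∀ x → x ≢ a → x ≢ b → P x x) →
                 ∀ x → P x (transpose a b x)
transpose-elim P a b Pab Pba Pxx x with x ≟ a
... | yes refl = Pab
... | no x≢a with x ≟ b
...   | yes refl = Pba
...   | no x≢b = Pxx x x≢a x≢b

transpose-first : ∀ {n} (a b : Fin n) → transpose a b a ≡ b
transpose-first a b = transpose-elim (λ x y → x ≡ a → y ≡ b) a b
  (λ _ → refl) sym (λ x x≢a _ x≡a → ⊥-elim (x≢a x≡a)) a refl

transpose-other : ∀ {n} {a b x : Fin n} → x ≢ a → x ≢ b → transpose a b x ≡ x
transpose-other {a = a} {b} {x} = transpose-elim
  (λ x y → x ≢ a → x ≢ b → y ≡ x) a b
  (λ a≢a _ → ⊥-elim (a≢a refl)) (λ _ b≢b → ⊥-elim (b≢b refl)) (λ _ _ _ _ _ → refl) x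

transpose-preserves : ∀ {n} (P : Fin n → Set) {a b : Fin n} → P a → P b →
                      ∀ {x} → P x → P (transpose a b x)
transpose-preserves P {a} {b} Pa Pb {x} = transpose-elim
  (λ x y → P x → P y) a b (λ _ → Pb) (λ _ → Pa) (λ _ _ _ Px → Px) x

transpose-injective : ∀ {n} (a b : Fin n) {x y} → transpose a b x ≡ transpose a b y → x ≡ y
transpose-injective a b {x} {y} e =
  trans (sym (transpose-inverse b a)) (trans (cong (transpose b a) e) (transpose-inverse b a))

module HookAssignments {n : ℕ} (π : Permutation′ n) (V : Subset n) where

  height : Fin n → Fin n
  height i = π ⟨$⟩ʳ i

  height-injective : ∀ {i j} → height i ≡ height j → i ≡ j
  height-injective = Injection.injective (↔⇒↣ π)

  descentTop? : Decidable (DescentTop π)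
  descentTop? i = FinP.any? λ i' → (toℕ i' ℕ.≟ ℕ.suc (toℕ i)) ×-dec (height i' FinP.<? height i)

  descentTop-irrelevant : ∀ {i} (d d' : DescentTop π i) → d ≡ d'
  descentTop-irrelevant (i₁ , e₁ , l₁) (i₂ , e₂ , l₂)
    with FinP.toℕ-injective (trans e₁ (sym e₂))
  ... | refl with ℕP.≡-irrelevant e₁ e₂ | FinP.<-irrelevant l₁ l₂
  ...   | refl | refl = refl

  Admissible : Fin n → Fin n → Set
  Admissible i j = IsHook π i j × NothingAbove π i j

  below-hook : ∀ {i j k} → NothingAbove π i j → i <ᶠ k → k <ᶠ j → height k <ᶠ height j
  below-hook nothingAbove i<k k<j = FinP.≤∧≢⇒< (ℕP.≮⇒≥ (nothingAbove _ i<k k<j))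
    (λ e → FinP.<⇒≢ k<j (height-injective e))

  -- A bijection from the descent tops onto V along admissible hooks; its
  -- values at other positions play no role.
  record Assignment : Set where
    field
      target     : Fin n → Fin n
      into       : ∀ i → DescentTop π i → target i ∈ V
      injective  : ∀ i i' → DescentTop π i → DescentTop π i' → target i ≡ target i' → i ≡ i'
      onto       : ∀ j → j ∈ V → ∃ λ i → DescentTop π i × target i ≡ j
      admissible : ∀ i → DescentTop π i → Admissible i (target i)

  open Assignment

  totalise : ((i : Fin n) → DescentTop π i → Fin n) → Fin n → Fin n
  totalise φ i with descentTop? i
  ... | yes d = φ i d
  ... | no _ = i

  totalise-agrees : ∀ φ i (d : DescentTop π i) → totalise φ i ≡ φ i d
  totalise-agrees φ i d with descentTop? i
  ... | yes d' = cong (φ i) (descentTop-irrelevant d' d)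
  ... | no ¬d = ⊥-elim (¬d d)

  fromBijection : (φ : (i : Fin n) → DescentTop π i → Fin n) →
    (∀ i (d : DescentTop π i) → φ i d ∈ V) →
    (∀ i i' (d : DescentTop π i) (d' : DescentTop π i') → φ i d ≡ φ i' d' → i ≡ i') →
    (∀ j → j ∈ V → Σ (Fin n) λ i → Σ (DescentTop π i) λ d → φ i d ≡ j) →
    (∀ i (d : DescentTop π i) → IsHook π i (φ i d)) →
    (∀ i (d : DescentTop π i) → NothingAbove π i (φ i d)) →
    Assignment
  fromBijection φ φ∈V φ-inj φ-surj φ-up φ-clear = record
    { target     = totalise φ
    ; into       = λ i d → subst (_∈ V) (sym (agrees i d)) (φ∈V i d)
    ; injective  = λ i i' d d' e → φ-inj i i' d d' (trans (sym (agrees i d)) (trans e (agrees i' d')))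
    ; onto       = λ j j∈V → let (i , d , e) = φ-surj j j∈V in i , d , trans (agrees i d) e
    ; admissible = λ i d → subst (Admissible i) (sym (agrees i d)) (φ-up i d , φ-clear i d)
    }
    where
    agrees = totalise-agrees φ

  Crossing : (Fin n → Fin n) → Fin n → Fin n → Set
  Crossing f k i' = k <ᶠ i' × i' <ᶠ f k × f k <ᶠ f i'

  Untangled : (Fin n → Fin n) → Fin n → Set
  Untangled f k = ∀ i' → DescentTop π i' → ¬ Crossing f k i'

  crossing? : ∀ f k → Dec (∃ λ i' → DescentTop π i' × Crossing f k i')
  crossing? f k = FinP.any? λ i' →
    descentTop? i' ×-dec (k FinP.<? i' ×-dec (i' FinP.<? f k ×-dec f k FinP.<? f i'))

  untangled-nested : ∀ {f k i'} → Untangled f k → DescentTop π i' →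
                     k <ᶠ i' → i' <ᶠ f k → f i' ≤ᶠ f k
  untangled-nested untangled di' k<i' i'<fk = ℕP.≮⇒≥ λ fk<fi' → untangled _ di' (k<i' , i'<fk , fk<fi')

  module Swap (s : Assignment) {k i' : Fin n}
              (dk : DescentTop π k) (di' : DescentTop π i')
              (crossing : Crossing (target s) k i') where

    f : Fin n → Fin n
    f = target s

    k<i' : k <ᶠ i'
    k<i' = proj₁ crossing
    i'<fk : i' <ᶠ f k
    i'<fk = proj₁ (proj₂ crossing)
    fk<fi' : f k <ᶠ f i'
    fk<fi' = proj₂ (proj₂ crossing)

    nothingAbove-k : NothingAbove π k (f k)
    nothingAbove-k = proj₂ (admissible s k dk)
    nothingAbove-i' : NothingAbove π i' (f i')
    nothingAbove-i' = proj₂ (admissible s i' di')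

    -- f k lies under the hook at i', hence below its top.
    height-fk<fi' : height (f k) <ᶠ height (f i')
    height-fk<fi' = below-hook nothingAbove-i' i'<fk fk<fi'

    -- The new hook from k to f i' is admissible: points up to f k are
    -- below the old hook at k, points beyond f k are below the hook at i'.
    admissible-k : Admissible k (f i')
    admissible-k = (FinP.<-trans k<i' (FinP.<-trans i'<fk fk<fi') ,
                    FinP.<-trans (proj₂ (proj₁ (admissible s k dk))) height-fk<fi') ,
                   nothingAbove
      where
      nothingAbove : NothingAbove π k (f i')
      nothingAbove m k<m m<fi' above with FinP.<-cmp m (f k)
      ... | tri< m<fk _ _ = FinP.<-asym above (FinP.<-trans (below-hook nothingAbove-k k<m m<fk) height-fk<fi')
      ... | tri≈ _ refl _ = FinP.<-asym above height-fk<fi'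
      ... | tri> _ _ fk<m = nothingAbove-i' m (FinP.<-trans i'<fk fk<m) m<fi' above

    -- The new hook from i' to f k lies inside the old hook at k.
    admissible-i' : Admissible i' (f k)
    admissible-i' = (i'<fk , below-hook nothingAbove-k k<i' i'<fk) ,
                    λ m i'<m → nothingAbove-k m (FinP.<-trans k<i' i'<m)

    τ : Fin n → Fin n
    τ = transpose k i'

    τ-descentTop : ∀ {x} → DescentTop π x → DescentTop π (τ x)
    τ-descentTop = transpose-preserves (DescentTop π) dk di'

    swapped : Assignment
    swapped = record
      { target     = f ∘ τ
      ; into       = λ x dx → into s (τ x) (τ-descentTop dx)
      ; injective  = λ x y dx dy e →
          transpose-injective k i' (injective s (τ x) (τ y) (τ-descentTop dx) (τ-descentTop dy) e)
      ; onto       = onto′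
      ; admissible = transpose-elim (λ x y → DescentTop π x → Admissible x (f y)) k i'
          (λ _ → admissible-k) (λ _ → admissible-i') (λ x _ _ → admissible s x)
      }
      where
      onto′ : ∀ j → j ∈ V → ∃ λ x → DescentTop π x × f (τ x) ≡ j
      onto′ j j∈V with onto s j j∈V
      ... | x , dx , e = transpose i' k x ,
                         transpose-preserves (DescentTop π) di' dk dx ,
                         trans (cong f (transpose-inverse k i')) e

    swapped-grows : f k <ᶠ target swapped k
    swapped-grows = subst (λ y → f k <ᶠ f y) (sym (transpose-first k i')) fk<fi'

    -- A hook at a descent top i left of k that crossed no hook still crosses
    -- none: the hooks at k and i' both lie under the hook at i whenever one of
    -- them starts there.
    preserves-untangled : ∀ {i} → i <ᶠ k → Untangled f i → Untangled (f ∘ τ) i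
    preserves-untangled {i} i<k untangled m dm (i<m , m<f′i , f′i<f′m) =
      transpose-elim (λ x y → DescentTop π x → ¬ (i <ᶠ x × x <ᶠ f i × f i <ᶠ f y)) k i'
        at-k at-i' (λ x _ _ dx → untangled x dx) m dm
        (i<m , subst (λ z → m <ᶠ f z) τi≡i m<f′i , subst (λ z → f z <ᶠ f (τ m)) τi≡i f′i<f′m)
      where
      i<i' : i <ᶠ i'
      i<i' = FinP.<-trans i<k k<i'
      τi≡i : τ i ≡ i
      τi≡i = transpose-other (FinP.<⇒≢ i<k) (FinP.<⇒≢ i<i')
      at-k : DescentTop π k → ¬ (i <ᶠ k × k <ᶠ f i × f i <ᶠ f i')
      at-k _ (_ , k<fi , fi<fi') = untangled i' di'
        (i<i' , ℕP.<-≤-trans i'<fk (untangled-nested untangled dk i<k k<fi) , fi<fi')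
      at-i' : DescentTop π i' → ¬ (i <ᶠ i' × i' <ᶠ f i × f i <ᶠ f k)
      at-i' _ (_ , i'<fi , fi<fk) = untangled k dk (i<k , FinP.<-trans k<i' i'<fi , fi<fk)

  UntangledBefore : Assignment → ℕ → Set
  UntangledBefore s c = ∀ i → toℕ i ℕ.< c → DescentTop π i → Untangled (target s) i

  -- Swapping at a descent top k until nothing crosses its hook; this
  -- terminates since the hook at k grows with every swap.
  untangleAt : ∀ {k} → DescentTop π k → (s : Assignment) → Acc _>ᶠ_ (target s k) →
               UntangledBefore s (toℕ k) →
               Σ Assignment λ s' → UntangledBefore s' (toℕ k) × Untangled (target s') k
  untangleAt {k} dk s (acc larger) before with crossing? (target s) k
  ... | no none = s , before , λ i' di' c → none (i' , di' , c)
  ... | yes (i' , di' , c) =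
    untangleAt dk swapped (larger swapped-grows)
      (λ i i<k di → preserves-untangled i<k (before i i<k di))
    where open Swap s dk di' c

  before-suc : ∀ (P : Fin n → Set) k → (∀ i → i <ᶠ k → P i) → P k →
               ∀ i → toℕ i ℕ.< ℕ.suc (toℕ k) → P i
  before-suc P k below Pk i i<1+k with ℕP.m<1+n⇒m<n∨m≡n i<1+k
  ... | inj₁ i<k = below i i<k
  ... | inj₂ i≡k = subst P (sym (FinP.toℕ-injective i≡k)) Pk

  sweepStep : ∀ k (s : Assignment) → UntangledBefore s (toℕ k) →
              Σ Assignment λ s' → UntangledBefore s' (ℕ.suc (toℕ k))
  sweepStep k s before with descentTop? k
  ... | no ¬dk = s , before-suc _ k before (λ dk → ⊥-elim (¬dk dk))
  ... | yes dk with untangleAt dk s (>-wellFounded _) before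
  ...   | s' , before' , atK = s' , before-suc _ k before' (λ _ → atK)

  sweep : (s : Assignment) → ∀ c → c ℕ.≤ n → Σ Assignment λ s' → UntangledBefore s' c
  sweep s ℕ.zero _ = s , λ _ ()
  sweep s (ℕ.suc c) c<n with sweep s c (ℕP.<⇒≤ c<n)
  ... | s₁ , before₁ =
    let (s' , before') = sweepStep k s₁ (subst (UntangledBefore s₁) (sym toℕk≡c) before₁)
    in s' , subst (λ m → UntangledBefore s' (ℕ.suc m)) toℕk≡c before'
    where
    k = fromℕ< c<n
    toℕk≡c = FinP.toℕ-fromℕ< c<n

  module Configuration (s : Assignment) (untangled : UntangledBefore s n) where

    f : Fin n → Fin n
    f = target s

    hooks : HookSet n
    hooks i j = DescentTop π i × f i ≡ j

    meets-at-corner : ∀ {a c} → DescentTop π a → DescentTop π c → a ≢ c →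
                      c ≤ᶠ a → a ≤ᶠ f c → height (f c) ≤ᶠ height (f a) → a ≡ f c
    meets-at-corner {a} {c} da dc a≢c c≤a a≤fc top-c≤top-a with FinP.<-cmp a (f c)
    ... | tri≈ _ a≡fc _ = a≡fc
    ... | tri> _ _ fc<a = ⊥-elim (ℕP.<⇒≱ fc<a a≤fc)
    ... | tri< a<fc _ _ = ⊥-elim (ℕP.<⇒≱ (below-hook (proj₂ (admissible s c dc)) c<fa fa<fc) top-c≤top-a)
      where
      c<a : c <ᶠ a
      c<a = FinP.≤∧≢⇒< c≤a (a≢c ∘ sym)
      fa<fc : f a <ᶠ f c
      fa<fc = FinP.≤∧≢⇒< (untangled-nested (untangled c (FinP.toℕ<n c) dc) da c<a a<fc)
                          (a≢c ∘ injective s a c da dc)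
      c<fa : c <ᶠ f a
      c<fa = FinP.<-trans c<a (proj₁ (proj₁ (admissible s a da)))

    vertical-meets-horizontal : ∀ {a c} → DescentTop π a → DescentTop π c → a ≢ c →
      ∀ {x y} → x ≡ ι a → y ℚ.≤ ι (height (f a)) →
      y ≡ ι (height (f c)) → ι c ℚ.≤ x → x ℚ.≤ ι (f c) → IsEndpoint π c (f c) x y
    vertical-meets-horizontal da dc a≢c refl y≤top-a refl c≤x x≤fc =
      inj₂ (cong ι (meets-at-corner da dc a≢c (ι-cancel-≤ c≤x) (ι-cancel-≤ x≤fc) (ι-cancel-≤ y≤top-a)) ,
            refl)

    noCrossing : ∀ i j i' j' → hooks i j → hooks i' j' → ((i ≡ i') × (j ≡ j') → ⊥) →
                 ∀ x y → OnHook π i j x y → OnHook π i' j' x y →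
                 IsEndpoint π i j x y ⊎ IsEndpoint π i' j' x y
    noCrossing a _ c _ (da , refl) (dc , refl) distinct x y = meet
      where
      a≢c : a ≢ c
      a≢c a≡c = distinct (a≡c , cong f a≡c)
      meet : OnHook π a (f a) x y → OnHook π c (f c) x y →
             IsEndpoint π a (f a) x y ⊎ IsEndpoint π c (f c) x y
      meet (inj₁ (x≡a , _)) (inj₁ (x≡c , _)) = ⊥-elim (a≢c (ι-injective (trans (sym x≡a) x≡c)))
      meet (inj₂ (y≡top-a , _)) (inj₂ (y≡top-c , _)) =
        ⊥-elim (a≢c (injective s a c da dc (height-injective (ι-injective (trans (sym y≡top-a) y≡top-c)))))
      meet (inj₁ (x≡a , _ , y≤top-a)) (inj₂ (y≡top-c , c≤x , x≤fc)) =
        inj₂ (vertical-meets-horizontal da dc a≢c x≡a y≤top-a y≡top-c c≤x x≤fc)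
      meet (inj₂ (y≡top-a , a≤x , x≤fa)) (inj₁ (x≡c , _ , y≤top-c)) =
        inj₁ (vertical-meets-horizontal dc da (a≢c ∘ sym) x≡c y≤top-c y≡top-a a≤x x≤fa)

    valid : ValidHookConfiguration π hooks
    valid = record
      { hooks      = λ { i j (d , refl) → proj₁ (admissible s i d) }
      ; southwest  = λ i → mk⇔ (λ { (_ , d , _) → d }) (λ d → f i , d , refl)
      ; noneAbove  = λ { i j (d , refl) → proj₂ (admissible s i d) }
      ; noCrossing = noCrossing
      }

    northeast : NortheastEndpoints hooks V
    northeast j = mk⇔ (λ { (i , d , refl) → into s i d }) (onto s j)

proposition2p3 : (n : ℕ) (π : Permutation′ n) (V : Subset n)
    (φ : (i : Fin n) → DescentTop π i → Fin n)
    (φ∈V : ∀ i (d : DescentTop π i) → φ i d ∈ V)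
    (φ-inj : ∀ i i' (d : DescentTop π i) (d' : DescentTop π i') → φ i d ≡ φ i' d' → i ≡ i')
    (φ-surj : ∀ j → j ∈ V → Σ (Fin n) λ i → Σ (DescentTop π i) λ d → φ i d ≡ j)
    (φ-up : ∀ i (d : DescentTop π i) → (i <ᶠ φ i d) × ((π ⟨$⟩ʳ i) <ᶠ (π ⟨$⟩ʳ φ i d)))
    (φ-clear : ∀ i (d : DescentTop π i) → NothingAbove π i (φ i d)) →
    Σ (HookSet n) λ H → ValidHookConfiguration π H × NortheastEndpoints H V
proposition2p3 n π V φ φ∈V φ-inj φ-surj φ-up φ-clear = hooks , valid , northeast
  where
  open HookAssignments π V
  initial : Assignment
  initial = fromBijection φ φ∈V φ-inj φ-surj φ-up φ-clear
  untangled : Σ Assignment λ s → UntangledBefore s n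
  untangled = sweep initial n ℕP.≤-refl
  open Configuration (proj₁ untangled) (proj₂ untangled)
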